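{- Let $\Sigma$ be a HIT-signature and let $A,B$ be algebras for $\Sigma$ in 1-types. Then $A$ and $B$ have a product in $\mathrm{Alg}(\Sigma)$ whose carrier is $A\times B$, with point constructor $x\mapsto(c_A(P(\pi_1)(x)),c_B(P(\pi_2)(x)))$ (where $P$ is the point-constructor code of $\Sigma$) and with the projections as the product 1-cells.
   Context: Work in homotopy type theory with univalence. A HIT-signature $\Sigma$ consists of a polynomial code $P$ (codes generated by constants $C_Z$, $\mathsf{Id}$, $+$, $\times$), path constructors given by pairs of path endpoints $l_j,r_j$ from a code $Q_j$ to $\mathsf{Id}$ ($j:J$), and homotopy constructors given by pairs of homotopy endpoints $h_k,h'_k$ with point arguments in a code $R_k$ and path arguments $w:[\![a_k]\!](x)=[\![b_k]\!](x)$ ($k:K$); endpoints are built from identity, composition, the point constructor, injections, projections, pairing, constants and function maps, and homotopy endpoints from reflexivity, inverse, concatenation, $\mathsf{ap}$, coherence laws, the path constructors and the path argument, all interpreted by structural recursion. $\mathrm{Alg}(\Sigma)$: objects are 1-types $X$ with $c_X:P(X)\to X$, paths $p^X_j(x):[\![l_j]\!](x)=[\![r_j]\!](x)$, and proofs of $[\![h_k]\!](x,w)=[\![h'_k]\!](x,w)$; 1-cells $f:X\to Y$ are maps with paths $f_c(x):f(c_X(x))=c_Y(P(f)(x))$ and, for each $j,x$, an equality $\mathsf{ap}_f(p^X_j(x))\bullet[\![r_j]\!](f)(x)=[\![l_j]\!](f)(x)\bullet p^Y_j(Q_j(f)(x))$ with $[\![e]\!](f)(x):f([\![e]\!](x))=[\![e]\!](Q_j(f)(x))$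 built from $f_c$; 2-cells $f\Rightarrow g$ are homotopies $\theta$ with $\theta(c_X(x))\bullet g_c(x)=f_c(x)\bullet\mathsf{ap}_{c_Y}(P(\theta)(x))$. In a bicategory, a product of $A$ and $B$ is an object $A\otimes B$ with 1-cells $\pi_1:A\otimes B\to A$, $\pi_2:A\otimes B\to B$ such that: for every $X$ and 1-cells $f:X\to A$, $g:X\to B$ there are a 1-cell $\langle f,g\rangle:X\to A\otimes B$ and 2-cells $\langle f,g\rangle\cdot\pi_1\Rightarrow f$, $\langle f,g\rangle\cdot\pi_2\Rightarrow g$; and given $h_1,h_2:X\to A\otimes B$ with 2-cells $\theta_i:h_i\cdot\pi_1\Rightarrow f$, $\theta'_i:h_i\cdot\pi_2\Rightarrow g$ ($i=1,2$), there is a unique 2-cell $\tau:h_1\Rightarrow h_2$ with $\tau\vartriangleright\pi_1\bullet\theta_2=\theta_1$ and $\tau\vartriangleright\pi_2\bullet\theta'_2=\theta'_1$ (composition in diagrammatic order). -}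

{-# OPTIONS --without-K #-}
module Defs where

open import Data.Product using (Σ; _×_; _,_; proj₁; proj₂)
open import Data.Sum using (_⊎_; inj₁; inj₂)
open import Function using (_∘_)
open import Relation.Binary.PropositionalEquality
  using (_≡_; refl; sym; trans; cong; cong₂; module ≡-Reasoning)

infixr 30 _∙_
_∙_ : ∀ {a} {A : Set a} {x y z : A} → x ≡ y → y ≡ z → x ≡ z
_∙_ = trans

isContr : ∀ {a} → Set a → Set a
isContr A = Σ A (λ c → ∀ x → c ≡ x)

is1Type : Set → Set
is1Type X = (x y : X) (p q : x ≡ y) (r s : p ≡ q) → r ≡ s

private
  assoc : ∀ {A : Set} {x y z u : A} (p : x ≡ y) (q : y ≡ z) (r : z ≡ u) →
          (p ∙ q) ∙ r ≡ p ∙ (q ∙ r)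
  assoc refl q r = refl

  ∙-refl : ∀ {A : Set} {x y : A} (p : x ≡ y) → p ∙ refl ≡ p
  ∙-refl refl = refl

  cong-∙ : ∀ {A B : Set} (f : A → B) {x y z : A} (p : x ≡ y) (q : y ≡ z) →
           cong f (p ∙ q) ≡ cong f p ∙ cong f q
  cong-∙ f refl q = refl

  cong-cong : ∀ {A B C : Set} (f : B → C) (g : A → B) {x y : A} (p : x ≡ y) →
              cong f (cong g p) ≡ cong (f ∘ g) p
  cong-cong f g refl = refl

  cong-sym : ∀ {A B : Set} (f : A → B) {x y : A} (p : x ≡ y) →
             sym (cong f p) ≡ cong f (sym p)
  cong-sym f refl = refl

  cong₂-∙ : ∀ {A B : Set} {a a' a'' : A} {b b' b'' : B}
            (p : a ≡ a') (p' : a' ≡ a'') (q : b ≡ b') (q' : b' ≡ b'') →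
            cong₂ _,_ (p ∙ p') (q ∙ q') ≡ cong₂ _,_ p q ∙ cong₂ _,_ p' q'
  cong₂-∙ refl p' refl q' = refl

  cong₂-sym : ∀ {A B : Set} {a a' : A} {b b' : B} (p : a ≡ a') (q : b ≡ b') →
              sym (cong₂ _,_ p q) ≡ cong₂ _,_ (sym p) (sym q)
  cong₂-sym refl refl = refl

  cong-cong₂ : ∀ {A B A' B' : Set} (F : A → A') (G : B → B')
               {a a' : A} {b b' : B} (p : a ≡ a') (q : b ≡ b') →
               cong (λ u → F (proj₁ u) , G (proj₂ u)) (cong₂ _,_ p q)
                 ≡ cong₂ _,_ (cong F p) (cong G q)
  cong-cong₂ F G refl refl = refl

infixr 6 _⊕_
infixr 7 _⊗_

data Code : Set₁ where
  C    : Set → Code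
  I    : Code
  _⊕_  : Code → Code → Code
  _⊗_  : Code → Code → Code

⟦_⟧ : Code → Set → Set
⟦ C Z ⟧   X = Z
⟦ I ⟧     X = X
⟦ P ⊕ Q ⟧ X = ⟦ P ⟧ X ⊎ ⟦ Q ⟧ X
⟦ P ⊗ Q ⟧ X = ⟦ P ⟧ X × ⟦ Q ⟧ X

pmap : (P : Code) {X Y : Set} → (X → Y) → ⟦ P ⟧ X → ⟦ P ⟧ Y
pmap (C Z)   f z        = z
pmap I       f x        = f x
pmap (P ⊕ Q) f (inj₁ x) = inj₁ (pmap P f x)
pmap (P ⊕ Q) f (inj₂ y) = inj₂ (pmap Q f y)
pmap (P ⊗ Q) f (x , y)  = pmap P f x , pmap Q f y

phtpy : (P : Code) {X Y : Set} {f g : X → Y} →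
        (∀ x → f x ≡ g x) → ∀ x → pmap P f x ≡ pmap P g x
phtpy (C Z)   θ z        = refl
phtpy I       θ x        = θ x
phtpy (P ⊕ Q) θ (inj₁ x) = cong inj₁ (phtpy P θ x)
phtpy (P ⊕ Q) θ (inj₂ y) = cong inj₂ (phtpy Q θ y)
phtpy (P ⊗ Q) θ (x , y)  = cong₂ _,_ (phtpy P θ x) (phtpy Q θ y)

pcomp : (P : Code) {X Y Z : Set} (f : X → Y) (g : Y → Z) →
        ∀ x → pmap P (g ∘ f) x ≡ pmap P g (pmap P f x)
pcomp (C Z)   f g z        = refl
pcomp I       f g x        = refl
pcomp (P ⊕ Q) f g (inj₁ x) = cong inj₁ (pcomp P f g x)
pcomp (P ⊕ Q) f g (inj₂ y) = cong inj₂ (pcomp Q f g y)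
pcomp (P ⊗ Q) f g (x , y)  = cong₂ _,_ (pcomp P f g x) (pcomp Q f g y)

data Endpoint (A : Code) : Code → Code → Set₁ where
  idE     : ∀ {P} → Endpoint A P P
  compE   : ∀ {P Q R} → Endpoint A P Q → Endpoint A Q R → Endpoint A P R
  constrE : Endpoint A A I
  inlE    : ∀ {P Q} → Endpoint A P (P ⊕ Q)
  inrE    : ∀ {P Q} → Endpoint A Q (P ⊕ Q)
  pr1E    : ∀ {P Q} → Endpoint A (P ⊗ Q) P
  pr2E    : ∀ {P Q} → Endpoint A (P ⊗ Q) Q
  pairE   : ∀ {P Q R} → Endpoint A P Q → Endpoint A P R → Endpoint A P (Q ⊗ R)
  constE  : ∀ {P} {Z : Set} → Z → Endpoint A P (C Z)
  fmapE   : ∀ {Z W : Set} → (Z → W) → Endpoint A (C Z) (C W)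

sem : ∀ {A P Q} → Endpoint A P Q → {X : Set} → (⟦ A ⟧ X → X) → ⟦ P ⟧ X → ⟦ Q ⟧ X
sem idE           c x        = x
sem (compE e₁ e₂) c x        = sem e₂ c (sem e₁ c x)
sem constrE       c x        = c x
sem inlE          c x        = inj₁ x
sem inrE          c x        = inj₂ x
sem pr1E          c x        = proj₁ x
sem pr2E          c x        = proj₂ x
sem (pairE e₁ e₂) c x        = sem e₁ c x , sem e₂ c x
sem (constE z)    c x        = z
sem (fmapE g)     c x        = g x

semMap : ∀ {A P Q} (e : Endpoint A P Q) {X Y : Set}
         (cX : ⟦ A ⟧ X → X) (cY : ⟦ A ⟧ Y → Y) (f : X → Y)
         (fc : ∀ x → f (cX x) ≡ cY (pmap A f x)) →
         ∀ x → pmap Q f (sem e cX x) ≡ sem e cY (pmap P f x)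
semMap idE           cX cY f fc x = refl
semMap (compE e₁ e₂) cX cY f fc x =
  semMap e₂ cX cY f fc (sem e₁ cX x) ∙ cong (sem e₂ cY) (semMap e₁ cX cY f fc x)
semMap constrE       cX cY f fc x = fc x
semMap inlE          cX cY f fc x = refl
semMap inrE          cX cY f fc x = refl
semMap pr1E          cX cY f fc x = refl
semMap pr2E          cX cY f fc x = refl
semMap (pairE e₁ e₂) cX cY f fc x =
  cong₂ _,_ (semMap e₁ cX cY f fc x) (semMap e₂ cX cY f fc x)
semMap (constE z)    cX cY f fc x = refl
semMap (fmapE g)     cX cY f fc x = refl

-- Parameters: the path constructors l r (indexed by
-- J with argument codes S j), the code Q of point arguments, and the
-- endpoints al ar : Q → T of the path argument w : ⟦al⟧(x) = ⟦ar⟧(x).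

data HEndpoint {A : Code} {J : Set} {S : J → Code}
               (l r : (j : J) → Endpoint A (S j) I)
               {Q T : Code} (al ar : Endpoint A Q T)
               : {U : Code} → Endpoint A Q U → Endpoint A Q U → Set₁ where
  reflH    : ∀ {U} (e : Endpoint A Q U) → HEndpoint l r al ar e e
  invH     : ∀ {U} {e₁ e₂ : Endpoint A Q U} →
             HEndpoint l r al ar e₁ e₂ → HEndpoint l r al ar e₂ e₁
  concatH  : ∀ {U} {e₁ e₂ e₃ : Endpoint A Q U} →
             HEndpoint l r al ar e₁ e₂ → HEndpoint l r al ar e₂ e₃ →
             HEndpoint l r al ar e₁ e₃
  apH      : ∀ {U V} {e₁ e₂ : Endpoint A Q U} (e₃ : Endpoint A U V) →
             HEndpoint l r al ar e₁ e₂ →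
             HEndpoint l r al ar (compE e₁ e₃) (compE e₂ e₃)
  assocH   : ∀ {U V W} (e₁ : Endpoint A Q U) (e₂ : Endpoint A U V) (e₃ : Endpoint A V W) →
             HEndpoint l r al ar (compE e₁ (compE e₂ e₃)) (compE (compE e₁ e₂) e₃)
  idlH     : ∀ {U} (e : Endpoint A Q U) → HEndpoint l r al ar (compE idE e) e
  idrH     : ∀ {U} (e : Endpoint A Q U) → HEndpoint l r al ar (compE e idE) e
  pr1PairH : ∀ {U V} (e₁ : Endpoint A Q U) (e₂ : Endpoint A Q V) →
             HEndpoint l r al ar (compE (pairE e₁ e₂) pr1E) e₁
  pr2PairH : ∀ {U V} (e₁ : Endpoint A Q U) (e₂ : Endpoint A Q V) →
             HEndpoint l r al ar (compE (pairE e₁ e₂) pr2E) e₂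
  pairH    : ∀ {U V} {e₁ e₂ : Endpoint A Q U} {e₃ e₄ : Endpoint A Q V} →
             HEndpoint l r al ar e₁ e₂ → HEndpoint l r al ar e₃ e₄ →
             HEndpoint l r al ar (pairE e₁ e₃) (pairE e₂ e₄)
  compPairH : ∀ {U V W} (e : Endpoint A Q U) (e₁ : Endpoint A U V) (e₂ : Endpoint A U W) →
             HEndpoint l r al ar (compE e (pairE e₁ e₂)) (pairE (compE e e₁) (compE e e₂))
  compConstH : ∀ {U} {Z : Set} (e : Endpoint A Q U) (z : Z) →
             HEndpoint l r al ar (compE e (constE z)) (constE z)
  pathConstrH : (j : J) (e : Endpoint A Q (S j)) →
             HEndpoint l r al ar (compE e (l j)) (compE e (r j))
  pathArgH : HEndpoint l r al ar al ar

semH : ∀ {A : Code} {J : Set} {S : J → Code} {l r : (j : J) → Endpoint A (S j) I} {Q T : Code} {al ar : Endpoint A Q T}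
       {U : Code} {e₁ e₂ : Endpoint A Q U} → HEndpoint l r al ar e₁ e₂ →
       {X : Set} (c : ⟦ A ⟧ X → X)
       (p : (j : J) (x : ⟦ S j ⟧ X) → sem (l j) c x ≡ sem (r j) c x)
       (x : ⟦ Q ⟧ X) → sem al c x ≡ sem ar c x → sem e₁ c x ≡ sem e₂ c x
semH (reflH e)           c p x w = refl
semH (invH h)            c p x w = sym (semH h c p x w)
semH (concatH h h')      c p x w = semH h c p x w ∙ semH h' c p x w
semH (apH e₃ h)          c p x w = cong (sem e₃ c) (semH h c p x w)
semH (assocH e₁ e₂ e₃)   c p x w = refl
semH (idlH e)            c p x w = refl
semH (idrH e)            c p x w = refl
semH (pr1PairH e₁ e₂)    c p x w = refl
semH (pr2PairH e₁ e₂)    c p x w = refl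
semH (pairH h h')        c p x w = cong₂ _,_ (semH h c p x w) (semH h' c p x w)
semH (compPairH e e₁ e₂) c p x w = refl
semH (compConstH e z)    c p x w = refl
semH {l = l} (pathConstrH j e) c p x w = p j (sem e c x)
semH pathArgH            c p x w = w

record Signature : Set₁ where
  field
    Pt        : Code
    J         : Set
    PArg      : J → Code
    pathL     : (j : J) → Endpoint Pt (PArg j) I
    pathR     : (j : J) → Endpoint Pt (PArg j) I
    K         : Set
    HArg      : K → Code
    HPathTgt  : K → Code
    hpa       : (k : K) → Endpoint Pt (HArg k) (HPathTgt k)
    hpb       : (k : K) → Endpoint Pt (HArg k) (HPathTgt k)
    hsrc      : (k : K) → Endpoint Pt (HArg k) I
    htgt      : (k : K) → Endpoint Pt (HArg k) I
    homL      : (k : K) → HEndpoint pathL pathR (hpa k) (hpb k) (hsrc k) (htgt k)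
    homR      : (k : K) → HEndpoint pathL pathR (hpa k) (hpb k) (hsrc k) (htgt k)

open Signature public

PathData : (S : Signature) (X : Set) → (⟦ Pt S ⟧ X → X) → Set
PathData S X c = (j : J S) (x : ⟦ PArg S j ⟧ X) → sem (pathL S j) c x ≡ sem (pathR S j) c x

HomotData : (S : Signature) (X : Set) (c : ⟦ Pt S ⟧ X → X) → PathData S X c → Set
HomotData S X c p =
  (k : K S) (x : ⟦ HArg S k ⟧ X) (w : sem (hpa S k) c x ≡ sem (hpb S k) c x) →
  semH (homL S k) c p x w ≡ semH (homR S k) c p x w

record Alg (S : Signature) : Set₁ where
  constructor mkAlg
  field
    Car   : Set
    trunc : is1Type Car
    c     : ⟦ Pt S ⟧ Car → Car
    p     : PathData S Car c
    hom   : HomotData S Car c p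

open Alg public

-- Underlying data of 1-cells (map + f_c), their composition, and 2-cells.
-- 2-cells of Alg(S) only depend on this part of a 1-cell.

record PreHom (P : Code) {X Y : Set} (cX : ⟦ P ⟧ X → X) (cY : ⟦ P ⟧ Y → Y) : Set where
  constructor mkPreHom
  field
    map  : X → Y
    mapc : ∀ x → map (cX x) ≡ cY (pmap P map x)

open PreHom public

-- composition in diagrammatic order:  F · G  =  G ∘ F
infixl 20 _·ᵖ_
_·ᵖ_ : ∀ {P} {X Y Z : Set} {cX : ⟦ P ⟧ X → X} {cY : ⟦ P ⟧ Y → Y} {cZ : ⟦ P ⟧ Z → Z} →
       PreHom P cX cY → PreHom P cY cZ → PreHom P cX cZ
_·ᵖ_ {P} {cZ = cZ} F G = mkPreHom (map G ∘ map F) λ x →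
  cong (map G) (mapc F x) ∙ mapc G (pmap P (map F) x)
    ∙ cong cZ (sym (pcomp P (map F) (map G) x))

record _⇒_ {P} {X Y : Set} {cX : ⟦ P ⟧ X → X} {cY : ⟦ P ⟧ Y → Y}
           (F G : PreHom P cX cY) : Set where
  constructor mkCell
  field
    htpy : ∀ x → map F x ≡ map G x
    coh  : ∀ x → htpy (cX x) ∙ mapc G x ≡ mapc F x ∙ cong cY (phtpy P htpy x)

open _⇒_ public

private
  phtpy-∙ : (P : Code) {X Y : Set} {f g h : X → Y}
            (θ : ∀ x → f x ≡ g x) (θ' : ∀ x → g x ≡ h x) →
            ∀ x → phtpy P (λ y → θ y ∙ θ' y) x ≡ phtpy P θ x ∙ phtpy P θ' x
  phtpy-∙ (C Z)   θ θ' z = refl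
  phtpy-∙ I       θ θ' x = refl
  phtpy-∙ (P ⊕ Q) θ θ' (inj₁ x) =
    cong (cong inj₁) (phtpy-∙ P θ θ' x) ∙ cong-∙ inj₁ (phtpy P θ x) (phtpy P θ' x)
  phtpy-∙ (P ⊕ Q) θ θ' (inj₂ y) =
    cong (cong inj₂) (phtpy-∙ Q θ θ' y) ∙ cong-∙ inj₂ (phtpy Q θ y) (phtpy Q θ' y)
  phtpy-∙ (P ⊗ Q) θ θ' (x , y) =
    cong₂ (cong₂ _,_) (phtpy-∙ P θ θ' x) (phtpy-∙ Q θ θ' y)
    ∙ cong₂-∙ (phtpy P θ x) (phtpy P θ' x) (phtpy Q θ y) (phtpy Q θ' y)

  natural : ∀ {A B C : Set} (cY : A → B) (h : B → C) (k : A → C)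
            (hc : ∀ a → h (cY a) ≡ k a) {a b : A} (q : a ≡ b) →
            cong h (cong cY q) ∙ hc b ≡ hc a ∙ cong k q
  natural cY h k hc {a} refl = sym (∙-refl (hc a))

  whiskL : (P : Code) {X Y Z : Set} {f g : X → Y} (h : Y → Z) (θ : ∀ x → f x ≡ g x) →
           ∀ x → cong (pmap P h) (phtpy P θ x) ∙ sym (pcomp P g h x)
                 ≡ sym (pcomp P f h x) ∙ phtpy P (λ y → cong h (θ y)) x
  whiskL (C Z) h θ z = refl
  whiskL I h θ x = ∙-refl (cong h (θ x))
  whiskL (P ⊕ Q) {f = f} {g} h θ (inj₁ x) =
    let a = phtpy P θ x ; b = pcomp P g h x ; b' = pcomp P f h x in
    cong₂ _∙_ (cong-cong (pmap (P ⊕ Q) h) inj₁ a ∙ sym (cong-cong inj₁ (pmap P h) a))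
              (cong-sym inj₁ b)
    ∙ sym (cong-∙ inj₁ (cong (pmap P h) a) (sym b))
    ∙ cong (cong inj₁) (whiskL P h θ x)
    ∙ cong-∙ inj₁ (sym b') (phtpy P (λ y → cong h (θ y)) x)
    ∙ cong (_∙ cong inj₁ (phtpy P (λ y → cong h (θ y)) x)) (sym (cong-sym inj₁ b'))
  whiskL (P ⊕ Q) {f = f} {g} h θ (inj₂ x) =
    let a = phtpy Q θ x ; b = pcomp Q g h x ; b' = pcomp Q f h x in
    cong₂ _∙_ (cong-cong (pmap (P ⊕ Q) h) inj₂ a ∙ sym (cong-cong inj₂ (pmap Q h) a))
              (cong-sym inj₂ b)
    ∙ sym (cong-∙ inj₂ (cong (pmap Q h) a) (sym b))
    ∙ cong (cong inj₂) (whiskL Q h θ x)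
    ∙ cong-∙ inj₂ (sym b') (phtpy Q (λ y → cong h (θ y)) x)
    ∙ cong (_∙ cong inj₂ (phtpy Q (λ y → cong h (θ y)) x)) (sym (cong-sym inj₂ b'))
  whiskL (P ⊗ Q) {f = f} {g} h θ (x , y) =
    cong₂ _∙_ (cong-cong₂ (pmap P h) (pmap Q h) (phtpy P θ x) (phtpy Q θ y))
              (cong₂-sym (pcomp P g h x) (pcomp Q g h y))
    ∙ sym (cong₂-∙ (cong (pmap P h) (phtpy P θ x)) (sym (pcomp P g h x))
                   (cong (pmap Q h) (phtpy Q θ y)) (sym (pcomp Q g h y)))
    ∙ cong₂ (cong₂ _,_) (whiskL P h θ x) (whiskL Q h θ y)
    ∙ cong₂-∙ (sym (pcomp P f h x)) (phtpy P (λ z → cong h (θ z)) x)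
              (sym (pcomp Q f h y)) (phtpy Q (λ z → cong h (θ z)) y)
    ∙ cong (_∙ cong₂ _,_ (phtpy P (λ z → cong h (θ z)) x) (phtpy Q (λ z → cong h (θ z)) y))
           (sym (cong₂-sym (pcomp P f h x) (pcomp Q f h y)))

infixl 15 _•_
_•_ : ∀ {P} {X Y : Set} {cX : ⟦ P ⟧ X → X} {cY : ⟦ P ⟧ Y → Y} {F G H : PreHom P cX cY} →
      F ⇒ G → G ⇒ H → F ⇒ H
_•_ {P} {cX = cX} {cY} {F} {G} {H} θ θ' = mkCell (λ x → htpy θ x ∙ htpy θ' x) λ x →
  let open ≡-Reasoning
      a = htpy θ (cX x) ; b = htpy θ' (cX x)
      q = phtpy P (htpy θ) x ; q' = phtpy P (htpy θ') x in
  begin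
    (a ∙ b) ∙ mapc H x                    ≡⟨ assoc a b (mapc H x) ⟩
    a ∙ (b ∙ mapc H x)                    ≡⟨ cong (a ∙_) (coh θ' x) ⟩
    a ∙ (mapc G x ∙ cong cY q')           ≡⟨ sym (assoc a (mapc G x) _) ⟩
    (a ∙ mapc G x) ∙ cong cY q'           ≡⟨ cong (_∙ cong cY q') (coh θ x) ⟩
    (mapc F x ∙ cong cY q) ∙ cong cY q'   ≡⟨ assoc (mapc F x) _ _ ⟩
    mapc F x ∙ (cong cY q ∙ cong cY q')   ≡⟨ cong (mapc F x ∙_) (sym (cong-∙ cY q q')) ⟩
    mapc F x ∙ cong cY (q ∙ q')           ≡⟨ cong (λ t → mapc F x ∙ cong cY t)
                                              (sym (phtpy-∙ P (htpy θ) (htpy θ') x)) ⟩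
    mapc F x ∙ cong cY (phtpy P (λ y → htpy θ y ∙ htpy θ' y) x)
  ∎

infixl 18 _▹_
_▹_ : ∀ {P} {X Y Z : Set} {cX : ⟦ P ⟧ X → X} {cY : ⟦ P ⟧ Y → Y} {cZ : ⟦ P ⟧ Z → Z}
      {F G : PreHom P cX cY} → F ⇒ G → (H : PreHom P cY cZ) → (F ·ᵖ H) ⇒ (G ·ᵖ H)
_▹_ {P} {cX = cX} {cY} {cZ} {F} {G} θ H = mkCell (λ x → cong (map H) (htpy θ x)) λ x →
  let open ≡-Reasoning
      h = map H ; f = map F ; g = map G
      t = htpy θ (cX x) ; q = phtpy P (htpy θ) x
      Rg = cong cZ (sym (pcomp P g h x)) ; Rf = cong cZ (sym (pcomp P f h x))
      q2 = phtpy P (λ y → cong h (htpy θ y)) x in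
  begin
    cong h t ∙ (cong h (mapc G x) ∙ mapc H (pmap P g x) ∙ Rg)
      ≡⟨ sym (assoc (cong h t) _ _) ⟩
    (cong h t ∙ cong h (mapc G x)) ∙ (mapc H (pmap P g x) ∙ Rg)
      ≡⟨ cong (_∙ (mapc H (pmap P g x) ∙ Rg))
              (sym (cong-∙ h t (mapc G x)) ∙ cong (cong h) (coh θ x)
               ∙ cong-∙ h (mapc F x) (cong cY q)) ⟩
    (cong h (mapc F x) ∙ cong h (cong cY q)) ∙ (mapc H (pmap P g x) ∙ Rg)
      ≡⟨ assoc (cong h (mapc F x)) _ _ ⟩
    cong h (mapc F x) ∙ (cong h (cong cY q) ∙ (mapc H (pmap P g x) ∙ Rg))
      ≡⟨ cong (cong h (mapc F x) ∙_) (sym (assoc (cong h (cong cY q)) _ _)) ⟩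
    cong h (mapc F x) ∙ ((cong h (cong cY q) ∙ mapc H (pmap P g x)) ∙ Rg)
      ≡⟨ cong (λ u → cong h (mapc F x) ∙ (u ∙ Rg))
              (natural cY h (λ a → cZ (pmap P h a)) (mapc H) q) ⟩
    cong h (mapc F x) ∙ ((mapc H (pmap P f x) ∙ cong (λ a → cZ (pmap P h a)) q) ∙ Rg)
      ≡⟨ cong (cong h (mapc F x) ∙_) (assoc (mapc H (pmap P f x)) _ _) ⟩
    cong h (mapc F x) ∙ mapc H (pmap P f x) ∙ (cong (λ a → cZ (pmap P h a)) q ∙ Rg)
      ≡⟨ cong (λ u → cong h (mapc F x) ∙ mapc H (pmap P f x) ∙ u)
              (cong (_∙ Rg) (sym (cong-cong cZ (pmap P h) q))
               ∙ sym (cong-∙ cZ (cong (pmap P h) q) (sym (pcomp P g h x)))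
               ∙ cong (cong cZ) (whiskL P h (htpy θ) x)
               ∙ cong-∙ cZ (sym (pcomp P f h x)) q2) ⟩
    cong h (mapc F x) ∙ mapc H (pmap P f x) ∙ (Rf ∙ cong cZ q2)
      ≡⟨ cong (cong h (mapc F x) ∙_) (sym (assoc (mapc H (pmap P f x)) Rf _)) ⟩
    cong h (mapc F x) ∙ ((mapc H (pmap P f x) ∙ Rf) ∙ cong cZ q2)
      ≡⟨ sym (assoc (cong h (mapc F x)) _ _) ⟩
    (cong h (mapc F x) ∙ mapc H (pmap P f x) ∙ Rf) ∙ cong cZ q2
  ∎

record Hom {S : Signature} (X Y : Alg S) : Set where
  constructor mkHom
  field
    fun : Car X → Car Y
    fc  : ∀ x → fun (c X x) ≡ c Y (pmap (Pt S) fun x)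
    fp  : (j : J S) (x : ⟦ PArg S j ⟧ (Car X)) →
          cong fun (p X j x) ∙ semMap (pathR S j) (c X) (c Y) fun fc x
            ≡ semMap (pathL S j) (c X) (c Y) fun fc x ∙ p Y j (pmap (PArg S j) fun x)

open Hom public

pre : ∀ {S} {X Y : Alg S} → Hom X Y → PreHom (Pt S) (c X) (c Y)
pre F = mkPreHom (fun F) (fc F)

Cell : ∀ {S} {X Y : Alg S} → Hom X Y → Hom X Y → Set
Cell F G = pre F ⇒ pre G

-- Products in the bicategory Alg(S)  (composition in diagrammatic order;
-- h · π is the composite 1-cell, whose 2-cells only see  pre h ·ᵖ pre π)

IsProduct : ∀ {S} (A B AB : Alg S) → Hom AB A → Hom AB B → Set₁
IsProduct {S} A B AB π₁ π₂ =
  ((X : Alg S) (f : Hom X A) (g : Hom X B) →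
     Σ (Hom X AB) λ fg → ((pre fg ·ᵖ pre π₁) ⇒ pre f) × ((pre fg ·ᵖ pre π₂) ⇒ pre g))
  ×
  ((X : Alg S) (f : Hom X A) (g : Hom X B) (h₁ h₂ : Hom X AB)
   (θ₁ : (pre h₁ ·ᵖ pre π₁) ⇒ pre f) (θ₁' : (pre h₁ ·ᵖ pre π₂) ⇒ pre g)
   (θ₂ : (pre h₂ ·ᵖ pre π₁) ⇒ pre f) (θ₂' : (pre h₂ ·ᵖ pre π₂) ⇒ pre g) →
     isContr (Σ (Cell h₁ h₂) λ τ →
       (((τ ▹ pre π₁) • θ₂) ≡ θ₁) × (((τ ▹ pre π₂) • θ₂') ≡ θ₁')))

prodC : ∀ {S} (A B : Alg S) → ⟦ Pt S ⟧ (Car A × Car B) → Car A × Car B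
prodC {S} A B x = c A (pmap (Pt S) proj₁ x) , c B (pmap (Pt S) proj₂ x)

prodAlg : ∀ {S} (A B : Alg S) (t : is1Type (Car A × Car B))
          (pp : PathData S (Car A × Car B) (prodC A B))
          (hh : HomotData S (Car A × Car B) (prodC A B) pp) → Alg S
prodAlg A B t pp hh = mkAlg (Car A × Car B) t (prodC A B) pp hh

{-# OPTIONS --without-K #-}
module Submission where

-- A path in A × B, and likewise a path between such paths, is determined by its two projections,
-- so everything about A × B can be checked componentwise.  The path constructors of A × B are
-- those of A and B pulled back along the projections, which makes the projections 1-cells with
-- trivial f_c; the homotopy constructors then hold because 1-cells commute with the
-- interpretation of homotopy endpoints.  The pairing ⟨F, G⟩ respects the path constructors
-- because its composites with the projections are F and G and 1-cells can be cancelled on the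
-- right.  A 2-cell into A × B is a pair of 2-cells into A and B, which forces the mediating cell
-- to be (θ₁ • θ₂⁻¹ , θ₁' • θ₂'⁻¹); it is unique because the 2-cells between two 1-cells into a
-- 1-type form a set (this is where function extensionality is used).

open import Defs
open import Level using (0ℓ)
open import Data.Product using (Σ; _×_; proj₁; proj₂; _,_)
open import Data.Product.Properties using (Σ-≡,≡→≡)
open import Data.Sum using (inj₁; inj₂)
open import Function using (_∘_)
open import Relation.Binary.PropositionalEquality
  using (_≡_; refl; sym; cong; cong₂; cong-app; subst; module ≡-Reasoning)
open import Relation.Binary.PropositionalEquality.Properties
  using (trans-assoc; trans-reflʳ; trans-symˡ; trans-injectiveˡ; cong-id; cong-∘; sym-cong; trans-cong)
open import Axiom.UniquenessOfIdentityProofs using (UIP; module Constant⇒UIP)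
open import Axiom.Extensionality.Propositional using (Extensionality)

homotopy-natural : ∀ {A B : Set} {f g : A → B} (H : ∀ a → f a ≡ g a) {a b : A} (p : a ≡ b) →
                   cong f p ∙ H b ≡ H a ∙ cong g p
homotopy-natural H {a} refl = sym (trans-reflʳ (H a))

square-sym : ∀ {A : Set} {u v w z : A} (a : u ≡ v) (b : v ≡ w) (c : u ≡ z) (d : z ≡ w) →
             a ∙ b ≡ c ∙ d → sym a ∙ c ≡ b ∙ sym d
square-sym refl refl c refl e = sym (e ∙ trans-reflʳ c)

∙-sym-∙-cancel : ∀ {A : Set} {x y z : A} (p : x ≡ y) (q : z ≡ y) → (p ∙ sym q) ∙ q ≡ p
∙-sym-∙-cancel refl refl = refl

∙-∙-sym-cancel : ∀ {A : Set} {x y z : A} (p : x ≡ y) (q : y ≡ z) → (p ∙ q) ∙ sym q ≡ p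
∙-∙-sym-cancel refl refl = refl

module _ {A B : Set} where

  cong-proj₁-cong₂ : {a a' : A} {b b' : B} (p : a ≡ a') (q : b ≡ b') →
                     cong proj₁ (cong₂ _,_ p q) ≡ p
  cong-proj₁-cong₂ refl refl = refl

  cong-proj₂-cong₂ : {a a' : A} {b b' : B} (p : a ≡ a') (q : b ≡ b') →
                     cong proj₂ (cong₂ _,_ p q) ≡ q
  cong-proj₂-cong₂ refl refl = refl

  cong₂-η : {u v : A × B} (p : u ≡ v) → cong₂ _,_ (cong proj₁ p) (cong proj₂ p) ≡ p
  cong₂-η refl = refl

  ×-path-ext : {u v : A × B} {r s : u ≡ v} →
               cong proj₁ r ≡ cong proj₁ s → cong proj₂ r ≡ cong proj₂ s → r ≡ s
  ×-path-ext {r = r} {s} e₁ e₂ = sym (cong₂-η r) ∙ cong₂ (cong₂ _,_) e₁ e₂ ∙ cong₂-η s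

sym-cong₂ : ∀ {A B : Set} {a a' : A} {b b' : B} (p : a ≡ a') (q : b ≡ b') →
            sym (cong₂ _,_ p q) ≡ cong₂ _,_ (sym p) (sym q)
sym-cong₂ refl refl = refl

is1Type⇒UIP : ∀ {X} → is1Type X → (x y : X) → UIP (x ≡ y)
is1Type⇒UIP t x y = t x y _ _

is1Type-× : ∀ {A B} → is1Type A → is1Type B → is1Type (A × B)
is1Type-× tA tB u v p q = Constant⇒UIP.≡-irrelevant viaProjections viaProjections-constant
  where
  viaProjections : {p q : u ≡ v} → p ≡ q → p ≡ q
  viaProjections {p} {q} r =
    sym (cong₂-η p) ∙ cong₂ (cong₂ _,_) (cong (cong proj₁) r) (cong (cong proj₂) r) ∙ cong₂-η q

  viaProjections-constant : {p q : u ≡ v} (r s : p ≡ q) → viaProjections r ≡ viaProjections s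
  viaProjections-constant {p} {q} r s =
    cong₂ (λ r₁ r₂ → sym (cong₂-η p) ∙ cong₂ (cong₂ _,_) r₁ r₂ ∙ cong₂-η q)
          (tA _ _ _ _ (cong (cong proj₁) r) (cong (cong proj₁) s))
          (tB _ _ _ _ (cong (cong proj₂) r) (cong (cong proj₂) s))

module _ (fe : Extensionality 0ℓ 0ℓ) where

  UIP-Π : {A : Set} {B : A → Set} → (∀ x → UIP (B x)) → UIP ((x : A) → B x)
  UIP-Π uip = Constant⇒UIP.≡-irrelevant (λ r → fe (cong-app r))
    λ r s → cong fe (fe λ x → uip x (cong-app r x) (cong-app s x))

  module _ {P : Code} {X Y : Set} {cX : ⟦ P ⟧ X → X} {cY : ⟦ P ⟧ Y → Y}
           {F G : PreHom P cX cY} (tY : is1Type Y) where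

    ⇒-ext : {θ θ' : F ⇒ G} → htpy θ ≡ htpy θ' → θ ≡ θ'
    ⇒-ext {mkCell h k} {mkCell .h k'} refl = cong (mkCell h) (fe λ x → is1Type⇒UIP tY _ _ (k x) (k' x))

    UIP-⇒ : UIP (F ⇒ G)
    UIP-⇒ = Constant⇒UIP.≡-irrelevant (λ r → ⇒-ext (cong htpy r))
      λ r s → cong ⇒-ext (UIP-Π (λ x → is1Type⇒UIP tY _ _) (cong htpy r) (cong htpy s))

phtpy-refl : (P : Code) {X Y : Set} (f : X → Y) → ∀ x → phtpy P {f = f} (λ _ → refl) x ≡ refl
phtpy-refl (C Z)   f z        = refl
phtpy-refl I       f x        = refl
phtpy-refl (P ⊕ Q) f (inj₁ x) = cong (cong inj₁) (phtpy-refl P f x)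
phtpy-refl (P ⊕ Q) f (inj₂ y) = cong (cong inj₂) (phtpy-refl Q f y)
phtpy-refl (P ⊗ Q) f (x , y)  = cong₂ (cong₂ _,_) (phtpy-refl P f x) (phtpy-refl Q f y)

phtpy-sym : (P : Code) {X Y : Set} {f g : X → Y} (θ : ∀ x → f x ≡ g x) →
            ∀ x → phtpy P (λ y → sym (θ y)) x ≡ sym (phtpy P θ x)
phtpy-sym (C Z)   θ z        = refl
phtpy-sym I       θ x        = refl
phtpy-sym (P ⊕ Q) θ (inj₁ x) = cong (cong inj₁) (phtpy-sym P θ x) ∙ sym (sym-cong (phtpy P θ x))
phtpy-sym (P ⊕ Q) θ (inj₂ y) = cong (cong inj₂) (phtpy-sym Q θ y) ∙ sym (sym-cong (phtpy Q θ y))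
phtpy-sym (P ⊗ Q) θ (x , y)  =
  cong₂ (cong₂ _,_) (phtpy-sym P θ x) (phtpy-sym Q θ y) ∙ sym (sym-cong₂ (phtpy P θ x) (phtpy Q θ y))

square-cong : ∀ {A B : Set} (ι : A → B) {s t w w' : A} (q : s ≡ t) (b : w ≡ t) (b' : w' ≡ s) (c : w' ≡ w) →
              q ∙ sym b ≡ sym b' ∙ c → cong ι q ∙ sym (cong ι b) ≡ sym (cong ι b') ∙ cong ι c
square-cong ι refl refl refl c e = cong (cong ι) e

square-cong₂ : ∀ {A A' B B' : Set} (k : A → A') (k' : B → B')
               {s t : A} {w w' : A'} (a : s ≡ t) (b : w ≡ k t) (b' : w' ≡ k s) (c : w' ≡ w)
               {s₂ t₂ : B} {v v' : B'} (a₂ : s₂ ≡ t₂) (d : v ≡ k' t₂) (d' : v' ≡ k' s₂) (e : v' ≡ v) →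
               cong k a ∙ sym b ≡ sym b' ∙ c → cong k' a₂ ∙ sym d ≡ sym d' ∙ e →
               cong (λ u → k (proj₁ u) , k' (proj₂ u)) (cong₂ _,_ a a₂) ∙ sym (cong₂ _,_ b d)
                 ≡ sym (cong₂ _,_ b' d') ∙ cong₂ _,_ c e
square-cong₂ k k' refl refl refl c refl refl refl e e₁ e₂ = cong₂ (cong₂ _,_) e₁ e₂

phtpy-whisker : (P : Code) {X Y Z : Set} {f g : X → Y} (h : Y → Z) (θ : ∀ x → f x ≡ g x) →
                ∀ x → cong (pmap P h) (phtpy P θ x) ∙ sym (pcomp P g h x)
                        ≡ sym (pcomp P f h x) ∙ phtpy P (λ y → cong h (θ y)) x
phtpy-whisker (C Z)   h θ z        = refl
phtpy-whisker I       h θ x        = trans-reflʳ (cong h (θ x))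
phtpy-whisker (P ⊕ Q) {f = f} {g} h θ (inj₁ x) =
  cong (_∙ _) (sym (cong-∘ {f = pmap (P ⊕ Q) h} {g = inj₁} (phtpy P θ x))
               ∙ cong-∘ {f = inj₁} {g = pmap P h} (phtpy P θ x))
  ∙ square-cong inj₁ (cong (pmap P h) (phtpy P θ x)) (pcomp P g h x) (pcomp P f h x)
                     (phtpy P (λ y → cong h (θ y)) x) (phtpy-whisker P h θ x)
phtpy-whisker (P ⊕ Q) {f = f} {g} h θ (inj₂ y) =
  cong (_∙ _) (sym (cong-∘ {f = pmap (P ⊕ Q) h} {g = inj₂} (phtpy Q θ y))
               ∙ cong-∘ {f = inj₂} {g = pmap Q h} (phtpy Q θ y))
  ∙ square-cong inj₂ (cong (pmap Q h) (phtpy Q θ y)) (pcomp Q g h y) (pcomp Q f h y)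
                     (phtpy Q (λ z → cong h (θ z)) y) (phtpy-whisker Q h θ y)
phtpy-whisker (P ⊗ Q) {f = f} {g} h θ (x , y) =
  square-cong₂ (pmap P h) (pmap Q h)
    (phtpy P θ x) (pcomp P g h x) (pcomp P f h x) (phtpy P (λ z → cong h (θ z)) x)
    (phtpy Q θ y) (pcomp Q g h y) (pcomp Q f h y) (phtpy Q (λ z → cong h (θ z)) y)
    (phtpy-whisker P h θ x) (phtpy-whisker Q h θ y)

module _ {P : Code} {X Y : Set} {cX : ⟦ P ⟧ X → X} {cY : ⟦ P ⟧ Y → Y} where

  IsCell : (F G : PreHom P cX cY) → (∀ x → map F x ≡ map G x) → Set
  IsCell F G τ = ∀ x → τ (cX x) ∙ mapc G x ≡ mapc F x ∙ cong cY (phtpy P τ x)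

  idCell : (F : PreHom P cX cY) → F ⇒ F
  idCell F = mkCell (λ _ → refl) λ x →
    sym (cong (λ q → mapc F x ∙ cong cY q) (phtpy-refl P (map F) x) ∙ trans-reflʳ (mapc F x))

  ≡⇒cell : {F G : PreHom P cX cY} → F ≡ G → F ⇒ G
  ≡⇒cell {F} refl = idCell F

  infix 30 _⁻¹
  _⁻¹ : {F G : PreHom P cX cY} → F ⇒ G → G ⇒ F
  _⁻¹ {F} {G} θ = mkCell (λ x → sym (htpy θ x)) λ x →
    square-sym (htpy θ (cX x)) (mapc G x) (mapc F x) (cong cY (phtpy P (htpy θ) x)) (coh θ x)
    ∙ cong (mapc G x ∙_) (sym-cong (phtpy P (htpy θ) x) ∙ cong (cong cY) (sym (phtpy-sym P (htpy θ) x)))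

module _ {P : Code} {X Y Z : Set} {cX : ⟦ P ⟧ X → X} {cY : ⟦ P ⟧ Y → Y} {cZ : ⟦ P ⟧ Z → Z} where

  whiskerʳ-reflects : (F G : PreHom P cX cY) (Q : PreHom P cY cZ) (τ : ∀ x → map F x ≡ map G x) →
    IsCell (F ·ᵖ Q) (G ·ᵖ Q) (λ x → cong (map Q) (τ x)) →
    ∀ x → cong (map Q) (τ (cX x) ∙ mapc G x) ≡ cong (map Q) (mapc F x ∙ cong cY (phtpy P τ x))
  whiskerʳ-reflects F G Q τ isCell x = trans-injectiveˡ (Qc₂ ∙ Z₂) (begin
      cong q (a ∙ m₂) ∙ (Qc₂ ∙ Z₂)                     ≡⟨ cong (_∙ Qc₂ ∙ Z₂) (sym (trans-cong a)) ⟩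
      (cong q a ∙ cong q m₂) ∙ (Qc₂ ∙ Z₂)              ≡⟨ trans-assoc (cong q a) ⟩
      cong q a ∙ (cong q m₂ ∙ (Qc₂ ∙ Z₂))              ≡⟨ isCell x ⟩
      (cong q m₁ ∙ (Qc₁ ∙ Z₁)) ∙ E                     ≡⟨ trans-assoc (cong q m₁) ∙ cong (cong q m₁ ∙_) (trans-assoc Qc₁) ⟩
      cong q m₁ ∙ (Qc₁ ∙ (Z₁ ∙ E))                     ≡⟨ cong (λ r → cong q m₁ ∙ (Qc₁ ∙ r)) (sym whiskered) ⟩
      cong q m₁ ∙ (Qc₁ ∙ (D ∙ Z₂))                     ≡⟨ cong (cong q m₁ ∙_) (sym (trans-assoc Qc₁)) ⟩
      cong q m₁ ∙ ((Qc₁ ∙ D) ∙ Z₂)                     ≡⟨ cong (λ r → cong q m₁ ∙ (r ∙ Z₂)) (sym naturality) ⟩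
      cong q m₁ ∙ ((cong q (cong cY Φ) ∙ Qc₂) ∙ Z₂)    ≡⟨ cong (cong q m₁ ∙_) (trans-assoc (cong q (cong cY Φ)))
                                                          ∙ sym (trans-assoc (cong q m₁)) ⟩
      (cong q m₁ ∙ cong q (cong cY Φ)) ∙ (Qc₂ ∙ Z₂)    ≡⟨ cong (_∙ Qc₂ ∙ Z₂) (trans-cong m₁) ⟩
      cong q (m₁ ∙ cong cY Φ) ∙ (Qc₂ ∙ Z₂)             ∎)
    where
    open ≡-Reasoning
    q = map Q
    a = τ (cX x)
    m₁ = mapc F x
    m₂ = mapc G x
    Φ = phtpy P τ x
    Qc₁ = mapc Q (pmap P (map F) x)
    Qc₂ = mapc Q (pmap P (map G) x)
    Z₁ = cong cZ (sym (pcomp P (map F) q x))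
    Z₂ = cong cZ (sym (pcomp P (map G) q x))
    D = cong cZ (cong (pmap P q) Φ)
    E = cong cZ (phtpy P (λ y → cong q (τ y)) x)

    naturality : cong q (cong cY Φ) ∙ Qc₂ ≡ Qc₁ ∙ D
    naturality = cong (_∙ Qc₂) (sym (cong-∘ Φ)) ∙ homotopy-natural (mapc Q) Φ ∙ cong (Qc₁ ∙_) (cong-∘ Φ)

    whiskered : D ∙ Z₂ ≡ Z₁ ∙ E
    whiskered = trans-cong (cong (pmap P q) Φ) ∙ cong (cong cZ) (phtpy-whisker P q τ x)
                ∙ sym (trans-cong (sym (pcomp P (map F) q x)))

semMapᵖ : ∀ {P Q U} (e : Endpoint P Q U) {X Y : Set} {cX : ⟦ P ⟧ X → X} {cY : ⟦ P ⟧ Y → Y}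
          (F : PreHom P cX cY) → ∀ x → pmap U (map F) (sem e cX x) ≡ sem e cY (pmap Q (map F) x)
semMapᵖ e F = semMap e _ _ (map F) (mapc F)

refl≡sym∙ : ∀ {A : Set} {x y : A} (q : x ≡ y) {r : x ≡ y} → q ≡ r → refl ≡ sym q ∙ r
refl≡sym∙ q refl = sym (trans-symˡ q)

cong-const : ∀ {A B : Set} (b : B) {x y : A} (p : x ≡ y) → refl ≡ cong (λ _ → b) p
cong-const b refl = refl

cong-sym-cancelʳ : ∀ {A B : Set} (h : A → B) {x y : B} {u v : A} (a : x ≡ y) (b : y ≡ h v) (p : u ≡ v) →
                   a ∙ b ≡ (a ∙ (b ∙ cong h (sym p))) ∙ cong h p
cong-sym-cancelʳ h a b refl = cong (a ∙_) (sym (trans-reflʳ b)) ∙ sym (trans-reflʳ _)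

cong₂-∙ : ∀ {A B : Set} {a a' a'' : A} {b b' b'' : B}
          (p : a ≡ a') (p' : a' ≡ a'') (q : b ≡ b') (q' : b' ≡ b'') →
          cong₂ _,_ (p ∙ p') (q ∙ q') ≡ cong₂ _,_ p q ∙ cong₂ _,_ p' q'
cong₂-∙ refl p' refl q' = refl

cong-cong₂ : ∀ {A B A' B' : Set} (F : A → A') (G : B → B') {a a' : A} {b b' : B} (p : a ≡ a') (q : b ≡ b') →
             cong (λ u → F (proj₁ u) , G (proj₂ u)) (cong₂ _,_ p q) ≡ cong₂ _,_ (cong F p) (cong G q)
cong-cong₂ F G refl refl = refl

cong₂-sym-∙ : ∀ {A B C : Set} (s₁ : A → B) (s₂ : A → C) {b₀ b₁ : B} {c₀ c₁ : C} {y y' : A}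
              (a : b₀ ≡ b₁) (a' : c₀ ≡ c₁) (b : b₀ ≡ s₁ y) (b' : c₀ ≡ s₂ y) (p : y ≡ y') →
              cong₂ _,_ (sym a ∙ (b ∙ cong s₁ p)) (sym a' ∙ (b' ∙ cong s₂ p))
                ≡ sym (cong₂ _,_ a a') ∙ (cong₂ _,_ b b' ∙ cong (λ z → s₁ z , s₂ z) p)
cong₂-sym-∙ s₁ s₂ refl refl b b' refl = cong₂ (cong₂ _,_) (trans-reflʳ b) (trans-reflʳ b') ∙ sym (trans-reflʳ _)

composite-square :
  ∀ {PZ QY QZ RY RZ : Set} (gQ : QY → QZ) (gR : RY → RZ) (s₁Z : PZ → QZ) (s₂Y : QY → RY) (s₂Z : QZ → RZ)
  (N : ∀ y → gR (s₂Y y) ≡ s₂Z (gQ y)) {a b : QY} {d : QZ} {t : RY} {u : RZ} {a₀ a₁ : PZ}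
  (M₁f : a ≡ b) (M₂f : t ≡ s₂Y a) (M₁g : gQ b ≡ s₁Z a₁) (pcR : u ≡ gR t) (pcQ : d ≡ gQ a)
  (M₂gf : u ≡ s₂Z d) (M₁gf : d ≡ s₁Z a₀) (pcP : a₀ ≡ a₁) →
  cong gR M₂f ∙ N a ≡ sym pcR ∙ (M₂gf ∙ cong s₂Z pcQ) →
  cong gQ M₁f ∙ M₁g ≡ sym pcQ ∙ (M₁gf ∙ cong s₁Z pcP) →
  cong gR (M₂f ∙ cong s₂Y M₁f) ∙ (N b ∙ cong s₂Z M₁g)
    ≡ sym pcR ∙ ((M₂gf ∙ cong s₂Z M₁gf) ∙ cong (s₂Z ∘ s₁Z) pcP)
composite-square gQ gR s₁Z s₂Y s₂Z N {a} refl refl M₁g refl refl M₂gf M₁gf refl e₂ e₁ =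
  cong (λ m → N a ∙ cong s₂Z m) (e₁ ∙ trans-reflʳ M₁gf)
  ∙ cong (_∙ cong s₂Z M₁gf) (e₂ ∙ trans-reflʳ M₂gf) ∙ sym (trans-reflʳ _)

module _ {P : Code} {X Y Z : Set} {cX : ⟦ P ⟧ X → X} {cY : ⟦ P ⟧ Y → Y} {cZ : ⟦ P ⟧ Z → Z}
         (F : PreHom P cX cY) (G : PreHom P cY cZ) where

  private
    f = map F
    g = map G

  semMap-·ᵖ : ∀ {Q U} (e : Endpoint P Q U) x →
    cong (pmap U g) (semMapᵖ e F x) ∙ semMapᵖ e G (pmap Q f x)
      ≡ sym (pcomp U f g (sem e cX x)) ∙ (semMapᵖ e (F ·ᵖ G) x ∙ cong (sem e cZ) (pcomp Q f g x))
  semMap-·ᵖ {Q} idE x = refl≡sym∙ _ (sym (cong-id (pcomp Q f g x)))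
  semMap-·ᵖ {Q} {U} (compE {Q = R} e₁ e₂) x =
    composite-square (pmap R g) (pmap U g) (sem e₁ cZ) (sem e₂ cY) (sem e₂ cZ) (semMapᵖ e₂ G)
      (semMapᵖ e₁ F x) (semMapᵖ e₂ F (sem e₁ cX x)) (semMapᵖ e₁ G (pmap Q f x))
      (pcomp U f g (sem e₂ cX (sem e₁ cX x))) (pcomp R f g (sem e₁ cX x))
      (semMapᵖ e₂ (F ·ᵖ G) (sem e₁ cX x)) (semMapᵖ e₁ (F ·ᵖ G) x) (pcomp Q f g x)
      (semMap-·ᵖ e₂ (sem e₁ cX x)) (semMap-·ᵖ e₁ x)
  semMap-·ᵖ constrE x = cong-sym-cancelʳ cZ (cong g (mapc F x)) (mapc G (pmap P f x)) (pcomp P f g x)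
  semMap-·ᵖ {Q} inlE x = refl≡sym∙ (cong inj₁ (pcomp Q f g x)) refl
  semMap-·ᵖ {Q} inrE x = refl≡sym∙ (cong inj₂ (pcomp Q f g x)) refl
  semMap-·ᵖ (pr1E {P₁} {P₂}) x = refl≡sym∙ _ (sym (cong-proj₁-cong₂ (pcomp P₁ f g (proj₁ x)) (pcomp P₂ f g (proj₂ x))))
  semMap-·ᵖ (pr2E {P₁} {P₂}) x = refl≡sym∙ _ (sym (cong-proj₂-cong₂ (pcomp P₁ f g (proj₁ x)) (pcomp P₂ f g (proj₂ x))))
  semMap-·ᵖ {Q} (pairE {Q = U₁} {R = U₂} e₁ e₂) x =
    cong (_∙ semMapᵖ (pairE e₁ e₂) G (pmap Q f x)) (cong-cong₂ (pmap U₁ g) (pmap U₂ g) (semMapᵖ e₁ F x) (semMapᵖ e₂ F x))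
    ∙ sym (cong₂-∙ (cong (pmap U₁ g) (semMapᵖ e₁ F x)) (semMapᵖ e₁ G (pmap Q f x))
                   (cong (pmap U₂ g) (semMapᵖ e₂ F x)) (semMapᵖ e₂ G (pmap Q f x)))
    ∙ cong₂ (cong₂ _,_) (semMap-·ᵖ e₁ x) (semMap-·ᵖ e₂ x)
    ∙ cong₂-sym-∙ (sem e₁ cZ) (sem e₂ cZ) (pcomp U₁ f g (sem e₁ cX x)) (pcomp U₂ f g (sem e₂ cX x))
        (semMapᵖ e₁ (F ·ᵖ G) x) (semMapᵖ e₂ (F ·ᵖ G) x) (pcomp Q f g x)
  semMap-·ᵖ {Q} (constE z) x = refl≡sym∙ refl (cong-const z (pcomp Q f g x))
  semMap-·ᵖ (fmapE h) x = refl

PreservesPaths : (S : Signature) {X Y : Set} {cX : ⟦ Pt S ⟧ X → X} {cY : ⟦ Pt S ⟧ Y → Y} →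
                 PathData S X cX → PathData S Y cY → PreHom (Pt S) cX cY → Set
PreservesPaths S pX pY F = ∀ j x →
  cong (map F) (pX j x) ∙ semMapᵖ (pathR S j) F x ≡ semMapᵖ (pathL S j) F x ∙ pY j (pmap (PArg S j) (map F) x)

-- A square  cong F H ∙ M' ≡ M ∙ H'  says that the family M carries the path H to H'.

natSquare-refl : ∀ {A : Set} {x y : A} {m₁ m₂ : x ≡ y} → m₂ ≡ m₁ → refl ∙ m₂ ≡ m₁ ∙ refl
natSquare-refl {m₁ = m₁} e = e ∙ sym (trans-reflʳ m₁)

natSquare-∙ : ∀ {X Y : Set} (F : X → Y) {a b e : X} {c d g : Y}
  (H₁ : a ≡ b) (H₂ : b ≡ e) (M₁ : F a ≡ c) (M₂ : F b ≡ d) (M₃ : F e ≡ g) (H₁' : c ≡ d) (H₂' : d ≡ g) →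
  cong F H₁ ∙ M₂ ≡ M₁ ∙ H₁' → cong F H₂ ∙ M₃ ≡ M₂ ∙ H₂' → cong F (H₁ ∙ H₂) ∙ M₃ ≡ M₁ ∙ (H₁' ∙ H₂')
natSquare-∙ F refl refl M₁ M₂ M₃ refl refl e₁ e₂ =
  e₂ ∙ trans-reflʳ M₂ ∙ e₁ ∙ trans-reflʳ M₁ ∙ sym (trans-reflʳ M₁)

natSquare-cong : ∀ {A B A' B' : Set} (k : A → B) (F : A → A') (F' : B → B') (k' : A' → B')
  (N : ∀ y → F' (k y) ≡ k' (F y)) {a b : A} {c d : A'} (H : a ≡ b) (M₁ : F a ≡ c) (M₂ : F b ≡ d) (H' : c ≡ d) →
  cong F H ∙ M₂ ≡ M₁ ∙ H' → cong F' (cong k H) ∙ (N b ∙ cong k' M₂) ≡ (N a ∙ cong k' M₁) ∙ cong k' H'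
natSquare-cong k F F' k' N {a} refl M₁ M₂ refl e =
  cong (λ m → N a ∙ cong k' m) (e ∙ trans-reflʳ M₁) ∙ sym (trans-reflʳ _)

natSquare-cong₂ : ∀ {A B A' B' : Set} (F : A → A') (G : B → B') {a b : A} {a' b' : B} {c d : A'} {c' d' : B'}
  (H₁ : a ≡ b) (H₂ : a' ≡ b') (M₁ : F a ≡ c) (M₂ : F b ≡ d) (M₃ : G a' ≡ c') (M₄ : G b' ≡ d')
  (H₁' : c ≡ d) (H₂' : c' ≡ d') →
  cong F H₁ ∙ M₂ ≡ M₁ ∙ H₁' → cong G H₂ ∙ M₄ ≡ M₃ ∙ H₂' →
  cong (λ u → F (proj₁ u) , G (proj₂ u)) (cong₂ _,_ H₁ H₂) ∙ cong₂ _,_ M₂ M₄ ≡ cong₂ _,_ M₁ M₃ ∙ cong₂ _,_ H₁' H₂'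
natSquare-cong₂ F G refl refl M₁ M₂ M₃ M₄ refl refl e₁ e₂ =
  cong₂ (cong₂ _,_) (e₁ ∙ trans-reflʳ M₁) (e₂ ∙ trans-reflʳ M₃) ∙ sym (trans-reflʳ _)

natSquare-homotopy : ∀ {X Y Z : Set} (f : X → Y) (L R : Z → Y) (K : ∀ z → L z ≡ R z)
  {y₁ y₂ : X} (H : y₁ ≡ y₂) {z₁ z₂ : Z} (Mr : f y₂ ≡ R z₁) (Ml : f y₁ ≡ L z₁) (Me : z₁ ≡ z₂) →
  cong f H ∙ Mr ≡ Ml ∙ K z₁ → cong f H ∙ (Mr ∙ cong R Me) ≡ (Ml ∙ cong L Me) ∙ K z₂
natSquare-homotopy f L R K H Mr Ml refl e =
  cong (cong f H ∙_) (trans-reflʳ Mr) ∙ e ∙ cong (_∙ K _) (sym (trans-reflʳ Ml))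

natSquare-conjugate : ∀ {A : Set} {a b c d : A} (w : a ≡ b) (Mr : b ≡ d) (Ml : a ≡ c) → w ∙ Mr ≡ Ml ∙ (sym Ml ∙ (w ∙ Mr))
natSquare-conjugate w Mr refl = refl

cong-∙-cong : ∀ {B C D : Set} (k : C → D) (k₂ : B → C) {t : D} {u : C} {v v' : B}
              (a : t ≡ k u) (b : u ≡ k₂ v) (c : v ≡ v') →
              a ∙ cong k (b ∙ cong k₂ c) ≡ (a ∙ cong k b) ∙ cong (k ∘ k₂) c
cong-∙-cong k k₂ a b refl = cong (λ q → a ∙ cong k q) (trans-reflʳ b) ∙ sym (trans-reflʳ _)

cong₂-∙-cong : ∀ {A B C : Set} (g : A → B) (h : A → C) {b : B} {c : C} {a a' : A}
               (p : b ≡ g a) (q : c ≡ h a) (m : a ≡ a') →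
               cong₂ _,_ (p ∙ cong g m) (q ∙ cong h m) ≡ cong₂ _,_ p q ∙ cong (λ y → g y , h y) m
cong₂-∙-cong g h p q refl = cong₂ (cong₂ _,_) (trans-reflʳ p) (trans-reflʳ q) ∙ sym (trans-reflʳ _)

module _ (S : Signature) {X Y : Set} {cX : ⟦ Pt S ⟧ X → X} {cY : ⟦ Pt S ⟧ Y → Y}
         (pX : PathData S X cX) (pY : PathData S Y cY) (F : PreHom (Pt S) cX cY) (Fp : PreservesPaths S pX pY F) where

  private
    f = map F
    M : ∀ {Q U} (e : Endpoint (Pt S) Q U) → ∀ x → pmap U f (sem e cX x) ≡ sem e cY (pmap Q f x)
    M e = semMapᵖ e F

  mapPathArg : ∀ {Q T} (al ar : Endpoint (Pt S) Q T) (x : ⟦ Q ⟧ X) →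
               sem al cX x ≡ sem ar cX x → sem al cY (pmap Q f x) ≡ sem ar cY (pmap Q f x)
  mapPathArg {T = T} al ar x w = sym (M al x) ∙ (cong (pmap T f) w ∙ M ar x)

  semH-natural : ∀ {Q T} {al ar : Endpoint (Pt S) Q T} {U} {e₁ e₂ : Endpoint (Pt S) Q U}
    (h : HEndpoint (pathL S) (pathR S) al ar e₁ e₂) (x : ⟦ Q ⟧ X) (w : sem al cX x ≡ sem ar cX x) →
    cong (pmap U f) (semH h cX pX x w) ∙ M e₂ x ≡ M e₁ x ∙ semH h cY pY (pmap Q f x) (mapPathArg al ar x w)
  semH-natural (reflH e) x w = natSquare-refl refl
  semH-natural {U = U} (invH {e₁ = e₁} {e₂} h) x w =
    cong (_∙ M e₁ x) (sym (sym-cong (semH h cX pX x w)))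
    ∙ square-sym (cong (pmap U f) (semH h cX pX x w)) (M e₂ x) (M e₁ x) _ (semH-natural h x w)
  semH-natural {U = U} (concatH {e₁ = e₁} {e₂} {e₃} h h') x w =
    natSquare-∙ (pmap U f) (semH h cX pX x w) (semH h' cX pX x w) (M e₁ x) (M e₂ x) (M e₃ x)
      _ _ (semH-natural h x w) (semH-natural h' x w)
  semH-natural (apH {U = U} {e₁ = e₁} {e₂} e₃ h) x w =
    natSquare-cong (sem e₃ cX) (pmap U f) _ (sem e₃ cY) (M e₃) (semH h cX pX x w) (M e₁ x) (M e₂ x) _
      (semH-natural h x w)
  semH-natural (assocH e₁ e₂ e₃) x w =
    natSquare-refl (cong-∙-cong (sem e₃ cY) (sem e₂ cY) (M e₃ (sem e₂ cX (sem e₁ cX x))) (M e₂ (sem e₁ cX x)) (M e₁ x))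
  semH-natural (idlH e) x w = natSquare-refl (sym (trans-reflʳ _))
  semH-natural (idrH e) x w = natSquare-refl (sym (cong-id _))
  semH-natural (pr1PairH e₁ e₂) x w = natSquare-refl (sym (cong-proj₁-cong₂ _ _))
  semH-natural (pr2PairH e₁ e₂) x w = natSquare-refl (sym (cong-proj₂-cong₂ _ _))
  semH-natural (pairH {U = U} {V} {e₁} {e₂} {e₃} {e₄} h h') x w =
    natSquare-cong₂ (pmap U f) (pmap V f) (semH h cX pX x w) (semH h' cX pX x w)
      (M e₁ x) (M e₂ x) (M e₃ x) (M e₄ x) _ _ (semH-natural h x w) (semH-natural h' x w)
  semH-natural (compPairH e e₁ e₂) x w =
    natSquare-refl (cong₂-∙-cong (sem e₁ cY) (sem e₂ cY) (M e₁ (sem e cX x)) (M e₂ (sem e cX x)) (M e x))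
  semH-natural (compConstH e z) x w = natSquare-refl (cong-const z (M e x))
  semH-natural (pathConstrH j e) x w =
    natSquare-homotopy f (sem (pathL S j) cY) (sem (pathR S j) cY) (pY j) (pX j (sem e cX x))
      (M (pathR S j) (sem e cX x)) (M (pathL S j) (sem e cX x)) (M e x) (Fp j (sem e cX x))
  semH-natural {T = T} {al} {ar} pathArgH x w = natSquare-conjugate (cong (pmap T f) w) (M ar x) (M al x)

preservesHomotopies : (S : Signature) {X : Set} {cX : ⟦ Pt S ⟧ X → X} (pX : PathData S X cX)
  (A : Alg S) (F : PreHom (Pt S) cX (c A)) → PreservesPaths S pX (p A) F →
  ∀ k x w → cong (map F) (semH (homL S k) cX pX x w) ≡ cong (map F) (semH (homR S k) cX pX x w)
preservesHomotopies S pX A F Fp k x w = trans-injectiveˡ (semMapᵖ (htgt S k) F x)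
  (semH-natural S pX (p A) F Fp (homL S k) x w
   ∙ cong (semMapᵖ (hsrc S k) F x ∙_) (hom A k _ _)
   ∙ sym (semH-natural S pX (p A) F Fp (homR S k) x w))

module _ (S : Signature) {X : Set} {cX : ⟦ Pt S ⟧ X → X} (A : Alg S) (F : PreHom (Pt S) cX (c A)) where

  pulledBackPath : (j : J S) (x : ⟦ PArg S j ⟧ X) → map F (sem (pathL S j) cX x) ≡ map F (sem (pathR S j) cX x)
  pulledBackPath j x =
    semMapᵖ (pathL S j) F x ∙ (p A j (pmap (PArg S j) (map F) x) ∙ sym (semMapᵖ (pathR S j) F x))

  preservesPaths-pulledBack : (pX : PathData S X cX) →
    (∀ j x → cong (map F) (pX j x) ≡ pulledBackPath j x) → PreservesPaths S pX (p A) F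
  preservesPaths-pulledBack pX e j x =
    cong (_∙ semMapᵖ (pathR S j) F x) (e j x ∙ sym (trans-assoc (semMapᵖ (pathL S j) F x)))
    ∙ ∙-sym-∙-cancel _ (semMapᵖ (pathR S j) F x)

module _ (S : Signature) {X Y Z : Set} {cX : ⟦ Pt S ⟧ X → X} {cY : ⟦ Pt S ⟧ Y → Y} {cZ : ⟦ Pt S ⟧ Z → Z}
         (pX : PathData S X cX) (pY : PathData S Y cY) (pZ : PathData S Z cZ)
         (F : PreHom (Pt S) cX cY) (G : PreHom (Pt S) cY cZ) where

  preservesPaths-cancelʳ : PreservesPaths S pY pZ G → PreservesPaths S pX pZ (F ·ᵖ G) →
    ∀ j x → cong (map G) (cong (map F) (pX j x) ∙ semMapᵖ (pathR S j) F x)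
              ≡ cong (map G) (semMapᵖ (pathL S j) F x ∙ pY j (pmap (PArg S j) (map F) x))
  preservesPaths-cancelʳ Gp FGp j x = trans-injectiveˡ R' (begin
      cong g (cong f (pX j x) ∙ MR) ∙ R'         ≡⟨ cong (_∙ R') (sym (trans-cong (cong f (pX j x)))) ⟩
      (cong g (cong f (pX j x)) ∙ cong g MR) ∙ R' ≡⟨ trans-assoc (cong g (cong f (pX j x)))
                                                    ∙ cong (_∙ cong g MR ∙ R') (sym (cong-∘ (pX j x))) ⟩
      cong (g ∘ f) (pX j x) ∙ (cong g MR ∙ R')    ≡⟨ cong (cong (g ∘ f) (pX j x) ∙_) (semMap-·ᵖ F G R x) ⟩
      cong (g ∘ f) (pX j x) ∙ (RR ∙ cR)           ≡⟨ sym (trans-assoc (cong (g ∘ f) (pX j x))) ⟩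
      (cong (g ∘ f) (pX j x) ∙ RR) ∙ cR           ≡⟨ cong (_∙ cR) (FGp j x) ⟩
      (LL ∙ pZ j (pmap Arg (g ∘ f) x)) ∙ cR       ≡⟨ trans-assoc LL ∙ cong (LL ∙_) (sym (homotopy-natural (pZ j) pc)) ⟩
      LL ∙ (cL ∙ pZ j (pmap Arg g y))             ≡⟨ sym (trans-assoc LL) ⟩
      (LL ∙ cL) ∙ pZ j (pmap Arg g y)             ≡⟨ cong (_∙ pZ j (pmap Arg g y)) (sym (semMap-·ᵖ F G L x)) ⟩
      (cong g ML ∙ L') ∙ pZ j (pmap Arg g y)      ≡⟨ trans-assoc (cong g ML) ∙ cong (cong g ML ∙_) (sym (Gp j y)) ⟩
      cong g ML ∙ (cong g (pY j y) ∙ R')          ≡⟨ sym (trans-assoc (cong g ML)) ⟩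
      (cong g ML ∙ cong g (pY j y)) ∙ R'          ≡⟨ cong (_∙ R') (trans-cong ML) ⟩
      cong g (ML ∙ pY j y) ∙ R'                   ∎)
    where
    open ≡-Reasoning
    f = map F
    g = map G
    L = pathL S j
    R = pathR S j
    Arg = PArg S j
    y = pmap Arg f x
    pc = pcomp Arg f g x
    ML = semMapᵖ L F x
    MR = semMapᵖ R F x
    L' = semMapᵖ L G y
    R' = semMapᵖ R G y
    LL = semMapᵖ L (F ·ᵖ G) x
    RR = semMapᵖ R (F ·ᵖ G) x
    cL = cong (sem L cZ) pc
    cR = cong (sem R cZ) pc

module ProductAlgebra (S : Signature) (A B : Alg S) where

  π₁ᵖ : PreHom (Pt S) (prodC A B) (c A)
  π₁ᵖ = mkPreHom proj₁ (λ _ → refl)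

  π₂ᵖ : PreHom (Pt S) (prodC A B) (c B)
  π₂ᵖ = mkPreHom proj₂ (λ _ → refl)

  pathsA×B : PathData S (Car A × Car B) (prodC A B)
  pathsA×B j y = cong₂ _,_ (pulledBackPath S A π₁ᵖ j y) (pulledBackPath S B π₂ᵖ j y)

  π₁-preservesPaths : PreservesPaths S pathsA×B (p A) π₁ᵖ
  π₁-preservesPaths = preservesPaths-pulledBack S A π₁ᵖ pathsA×B λ j y → cong-proj₁-cong₂ _ _

  π₂-preservesPaths : PreservesPaths S pathsA×B (p B) π₂ᵖ
  π₂-preservesPaths = preservesPaths-pulledBack S B π₂ᵖ pathsA×B λ j y → cong-proj₂-cong₂ _ _

  homotopiesA×B : HomotData S (Car A × Car B) (prodC A B) pathsA×B
  homotopiesA×B k x w = ×-path-ext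
    (preservesHomotopies S pathsA×B A π₁ᵖ π₁-preservesPaths k x w)
    (preservesHomotopies S pathsA×B B π₂ᵖ π₂-preservesPaths k x w)

  truncA×B : is1Type (Car A × Car B)
  truncA×B = is1Type-× (trunc A) (trunc B)

  A×B : Alg S
  A×B = prodAlg A B truncA×B pathsA×B homotopiesA×B

  π₁ : Hom A×B A
  π₁ = mkHom proj₁ (λ _ → refl) π₁-preservesPaths

  π₂ : Hom A×B B
  π₂ = mkHom proj₂ (λ _ → refl) π₂-preservesPaths

  ⟨_,_⟩ᵖ : {X : Set} {cX : ⟦ Pt S ⟧ X → X} → PreHom (Pt S) cX (c A) → PreHom (Pt S) cX (c B) →
           PreHom (Pt S) cX (prodC A B)
  ⟨ F , G ⟩ᵖ = mkPreHom (λ x → map F x , map G x) λ x →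
    cong₂ _,_ (mapc F x ∙ cong (c A) (pcomp (Pt S) (λ y → map F y , map G y) proj₁ x))
              (mapc G x ∙ cong (c B) (pcomp (Pt S) (λ y → map F y , map G y) proj₂ x))

  module _ (fe : Extensionality 0ℓ 0ℓ) where

    ⟨⟩ᵖ-·π₁ : {X : Set} {cX : ⟦ Pt S ⟧ X → X} (F : PreHom (Pt S) cX (c A)) (G : PreHom (Pt S) cX (c B)) →
              ⟨ F , G ⟩ᵖ ·ᵖ π₁ᵖ ≡ F
    ⟨⟩ᵖ-·π₁ F G = cong (mkPreHom (map F)) (fe λ x →
      let pc = pcomp (Pt S) (λ y → map F y , map G y) proj₁ x in
      cong₂ _∙_ (cong-proj₁-cong₂ (mapc F x ∙ cong (c A) pc) _) (sym (sym-cong pc))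
      ∙ ∙-∙-sym-cancel (mapc F x) (cong (c A) pc))

    ⟨⟩ᵖ-·π₂ : {X : Set} {cX : ⟦ Pt S ⟧ X → X} (F : PreHom (Pt S) cX (c A)) (G : PreHom (Pt S) cX (c B)) →
              ⟨ F , G ⟩ᵖ ·ᵖ π₂ᵖ ≡ G
    ⟨⟩ᵖ-·π₂ F G = cong (mkPreHom (map G)) (fe λ x →
      let pc = pcomp (Pt S) (λ y → map F y , map G y) proj₂ x in
      cong₂ _∙_ (cong-proj₂-cong₂ _ (mapc G x ∙ cong (c B) pc)) (sym (sym-cong pc))
      ∙ ∙-∙-sym-cancel (mapc G x) (cong (c B) pc))

    ⟨_,_⟩ : {X : Alg S} → Hom X A → Hom X B → Hom X A×B
    ⟨_,_⟩ {X} F G = mkHom (map FG) (mapc FG) λ j x → ×-path-ext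
      (preservesPaths-cancelʳ S (p X) pathsA×B (p A) FG π₁ᵖ π₁-preservesPaths
        (subst (PreservesPaths S (p X) (p A)) (sym (⟨⟩ᵖ-·π₁ (pre F) (pre G))) (fp F)) j x)
      (preservesPaths-cancelʳ S (p X) pathsA×B (p B) FG π₂ᵖ π₂-preservesPaths
        (subst (PreservesPaths S (p X) (p B)) (sym (⟨⟩ᵖ-·π₂ (pre F) (pre G))) (fp G)) j x)
      where
      FG = ⟨ pre F , pre G ⟩ᵖ

    pairCell : {X : Set} {cX : ⟦ Pt S ⟧ X → X} {H₁ H₂ : PreHom (Pt S) cX (prodC A B)} →
               (H₁ ·ᵖ π₁ᵖ) ⇒ (H₂ ·ᵖ π₁ᵖ) → (H₁ ·ᵖ π₂ᵖ) ⇒ (H₂ ·ᵖ π₂ᵖ) → H₁ ⇒ H₂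
    pairCell {H₁ = H₁} {H₂} σ₁ σ₂ = mkCell τ λ x → ×-path-ext
      (whiskerʳ-reflects H₁ H₂ π₁ᵖ τ
        (subst (IsCell (H₁ ·ᵖ π₁ᵖ) (H₂ ·ᵖ π₁ᵖ)) (fe λ y → sym (cong-proj₁-cong₂ _ _)) (coh σ₁)) x)
      (whiskerʳ-reflects H₁ H₂ π₂ᵖ τ
        (subst (IsCell (H₁ ·ᵖ π₂ᵖ) (H₂ ·ᵖ π₂ᵖ)) (fe λ y → sym (cong-proj₂-cong₂ _ _)) (coh σ₂)) x)
      where
      τ : ∀ x → map H₁ x ≡ map H₂ x
      τ x = cong₂ _,_ (htpy σ₁ x) (htpy σ₂ x)

    module Mediation {X : Alg S} (F : Hom X A) (G : Hom X B) (h₁ h₂ : Hom X A×B)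
             (θ₁ : (pre h₁ ·ᵖ π₁ᵖ) ⇒ pre F) (θ₁' : (pre h₁ ·ᵖ π₂ᵖ) ⇒ pre G)
             (θ₂ : (pre h₂ ·ᵖ π₁ᵖ) ⇒ pre F) (θ₂' : (pre h₂ ·ᵖ π₂ᵖ) ⇒ pre G) where

      Mediating : Set
      Mediating = Σ (Cell h₁ h₂) λ τ → (((τ ▹ π₁ᵖ) • θ₂) ≡ θ₁) × (((τ ▹ π₂ᵖ) • θ₂') ≡ θ₁')

      mediating : Mediating
      mediating = τ
        , ⇒-ext fe (trunc A) (fe λ x →
            cong (_∙ htpy θ₂ x) (cong-proj₁-cong₂ _ _) ∙ ∙-sym-∙-cancel (htpy θ₁ x) (htpy θ₂ x))
        , ⇒-ext fe (trunc B) (fe λ x →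
            cong (_∙ htpy θ₂' x) (cong-proj₂-cong₂ _ _) ∙ ∙-sym-∙-cancel (htpy θ₁' x) (htpy θ₂' x))
        where
        τ : Cell h₁ h₂
        τ = pairCell (θ₁ • θ₂ ⁻¹) (θ₁' • θ₂' ⁻¹)

      mediating-unique : (u v : Mediating) → u ≡ v
      mediating-unique (τ , e₁ , e₂) (τ' , e₁' , e₂') = Σ-≡,≡→≡
        ( ⇒-ext fe truncA×B (fe λ x → ×-path-ext
            (trans-injectiveˡ (htpy θ₂ x) (cong (λ θ → htpy θ x) e₁ ∙ sym (cong (λ θ → htpy θ x) e₁')))
            (trans-injectiveˡ (htpy θ₂' x) (cong (λ θ → htpy θ x) e₂ ∙ sym (cong (λ θ → htpy θ x) e₂'))))
        , cong₂ _,_ (UIP-⇒ fe (trunc A) _ _) (UIP-⇒ fe (trunc B) _ _))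

    isProduct : IsProduct A B A×B π₁ π₂
    isProduct = (λ X F G → ⟨ F , G ⟩ , ≡⇒cell (⟨⟩ᵖ-·π₁ (pre F) (pre G)) , ≡⇒cell (⟨⟩ᵖ-·π₂ (pre F) (pre G)))
              , λ X F G h₁ h₂ θ₁ θ₁' θ₂ θ₂' →
                  let open Mediation F G h₁ h₂ θ₁ θ₁' θ₂ θ₂' in mediating , mediating-unique mediating

mainTheorem8 : Extensionality 0ℓ 0ℓ →
    (S : Signature) (A B : Alg S) →
    Σ (is1Type (Car A × Car B)) λ t →
    Σ (PathData S (Car A × Car B) (prodC A B)) λ pp →
    Σ (HomotData S (Car A × Car B) (prodC A B) pp) λ hh →
    Σ (Hom (prodAlg A B t pp hh) A) λ π₁ →
    Σ (Hom (prodAlg A B t pp hh) B) λ π₂ →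
      (fun π₁ ≡ proj₁) × (fun π₂ ≡ proj₂)
      × IsProduct A B (prodAlg A B t pp hh) π₁ π₂
mainTheorem8 fe S A B = truncA×B , pathsA×B , homotopiesA×B , π₁ , π₂ , refl , refl , isProduct fe
  where open ProductAlgebra S A B
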